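{- Let $M$ be a reduced monoid and let $N$ be a submonoid of $M$. Then: (1) $\mathcal{P}_{\mathrm{fin},0}(N)$ is a divisor-closed submonoid of $\mathcal{P}_{\mathrm{fin},0}(M)$; (2) $\mathcal{A}(\mathcal{P}_{\mathrm{fin},0}(N)) = \mathcal{P}_{\mathrm{fin},0}(N) \cap \mathcal{A}(\mathcal{P}_{\mathrm{fin},0}(M))$.
   Context: Throughout, "monoid" means a cancellative, commutative semigroup with identity, written additively; it is reduced if its only invertible element is $0$. For a monoid $M$, $\mathcal{P}_{\mathrm{fin}}(M)$ is the set of nonempty finite subsets of $M$ with the sumset operation $B+C=\{b+c : b\in B, c\in C\}$, and $\mathcal{P}_{\mathrm{fin},0}(M)=\{S\in\mathcal{P}_{\mathrm{fin}}(M): 0\in S\}$ (the restricted power monoid). For $b,c$ in a monoid $H$, $b \mid_H c$ means $c=b+b'$ for some $b'\in H$. A submonoid $S$ of $H$ is divisor-closed if whenever $b\in H$, $c\in S$ and $b\mid_H c$, then $b\in S$. An atom of $H$ is a non-invertible element $a$ such that $a=u+v$ with $u,v\in H$ implies $u$ or $v$ is invertible; $\mathcal{A}(H)$ denotes the set of atoms of $H$. -}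

module Defs where

open import Level using (Level; _⊔_; suc)
open import Algebra.Bundles using (CommutativeMonoid)
open import Data.Product using (Σ; ∃; _×_; _,_)
open import Data.Sum using (_⊎_)
open import Data.Unit.Polymorphic using (⊤)
open import Data.List using (List; [_]; cartesianProductWith)
open import Data.List.Relation.Unary.All using (All)
open import Relation.Nullary using (¬_)
open import Relation.Unary using (Pred)
open import Function.Bundles using (_⇔_)
import Data.List.Membership.Setoid as SetoidMembership

-- Generic notions for a (commutative) operation on a carrier with an
-- equality, relative to a predicate H carving out the monoid under
-- consideration (H may be a submonoid of a larger ambient structure).

module Generic {a ℓ : Level} (A : Set a) (_≈_ : A → A → Set ℓ)
                (_∙_ : A → A → A) (ε : A) where

  InvertibleIn : ∀ {p} → Pred A p → A → Set (a ⊔ ℓ ⊔ p)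
  InvertibleIn H b = Σ A λ b' → H b' × ((b ∙ b') ≈ ε)

  DividesIn : ∀ {p} → Pred A p → A → A → Set (a ⊔ ℓ ⊔ p)
  DividesIn H b c = Σ A λ b' → H b' × (c ≈ (b ∙ b'))

  IsAtomIn : ∀ {p} → Pred A p → A → Set (a ⊔ ℓ ⊔ p)
  IsAtomIn H x = H x × ¬ InvertibleIn H x ×
    (∀ u v → H u → H v → x ≈ (u ∙ v) → InvertibleIn H u ⊎ InvertibleIn H v)

  record IsSubmonoidOf {p q} (S : Pred A p) (H : Pred A q) : Set (a ⊔ ℓ ⊔ p ⊔ q) where
    field
      ⊆H      : ∀ x → S x → H x
      ε∈      : S ε
      ∙-closed : ∀ x y → S x → S y → S (x ∙ y)
      resp    : ∀ x y → x ≈ y → S x → S y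

  DivisorClosedIn : ∀ {p q} → Pred A p → Pred A q → Set (a ⊔ ℓ ⊔ p ⊔ q)
  DivisorClosedIn S H = ∀ b c → H b → S c → DividesIn H b c → S b

-- Monoids in the sense of the paper: cancellative commutative monoids

module _ {c ℓ : Level} (M : CommutativeMonoid c ℓ) where
  open CommutativeMonoid M renaming (Carrier to A; _∙_ to _+_; ε to 0#)

  Cancellative : Set (c ⊔ ℓ)
  Cancellative = ∀ x y z → (x + y) ≈ (x + z) → y ≈ z

  Reduced : Set (c ⊔ ℓ)
  Reduced = ∀ x → Generic.InvertibleIn A _≈_ _+_ 0# (λ _ → ⊤ {c}) x → x ≈ 0#

  record IsSubmonoid {n} (N : Pred A n) : Set (c ⊔ ℓ ⊔ n) where
    field
      0∈      : N 0#
      +-closed : ∀ x y → N x → N y → N (x + y)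
      resp    : ∀ x y → x ≈ y → N x → N y

  open SetoidMembership setoid using (_∈_)

  -- finite subsets of M are represented by lists; two lists represent
  -- the same subset when they have the same members (up to ≈)
  _≋_ : List A → List A → Set (c ⊔ ℓ)
  B ≋ C = ∀ x → (x ∈ B) ⇔ (x ∈ C)

  _⊕_ : List A → List A → List A
  B ⊕ C = cartesianProductWith _+_ B C

  𝟘 : List A
  𝟘 = [ 0# ]

  Pfin0 : Pred (List A) (c ⊔ ℓ)
  Pfin0 S = 0# ∈ S

  Pfin0Sub : ∀ {n} → Pred A n → Pred (List A) (c ⊔ ℓ ⊔ n)
  Pfin0Sub N S = (0# ∈ S) × All N S

  module PowerMonoid = Generic (List A) _≋_ _⊕_ 𝟘

-- In P_fin,0(M) every factor of a product divides it in the strong sense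
-- of being a subset of it, because the other factor contains 0: if
-- S = B + C and 0 ∈ C then B ⊆ S. Hence a factorisation of a set of
-- elements of N only involves sets of elements of N, so P_fin,0(N) is
-- divisor-closed, and in any commutative monoid the atoms of a
-- divisor-closed submonoid are exactly its elements that are atoms of the
-- ambient monoid.
module Submission where

open import Defs
open import Algebra.Bundles using (CommutativeMonoid)
open import Algebra.Definitions using (Commutative)
open import Data.Product using (_×_; _,_; ∃₂; proj₁)
import Data.Sum as Sum
open import Data.List using (List)
open import Data.List.Relation.Unary.Any using (here)
open import Data.List.Relation.Unary.All using (All; []; _∷_; tabulateₛ; lookupₛ)
open import Relation.Binary.Core using (Rel)
open import Relation.Binary.Definitions using (Symmetric; Transitive)
open import Relation.Unary using (Pred)
open import Function.Bundles using (_⇔_; mk⇔; Equivalence)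
import Function.Properties.Equivalence as ⇔
import Data.List.Membership.Setoid as SetoidMembership
import Data.List.Membership.Setoid.Properties as SetoidMembershipProperties

module DivisorClosedSubmonoid
  {a ℓ} {A : Set a} {_≈_ : Rel A ℓ} {_∙_ : A → A → A} {ε : A}
  (≈-sym : Symmetric _≈_) (≈-trans : Transitive _≈_)
  (∙-comm : Commutative _≈_ _∙_) where

  open Generic A _≈_ _∙_ ε

  module _ {p q} {S : Pred A p} {H : Pred A q}
           (S≤H : IsSubmonoidOf S H) (closed : DivisorClosedIn S H) where
    open IsSubmonoidOf S≤H

    invertibleIn-⊆ : ∀ {x} → InvertibleIn S x → InvertibleIn H x
    invertibleIn-⊆ (x′ , Sx′ , x∙x′≈ε) = x′ , ⊆H x′ Sx′ , x∙x′≈ε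

    -- The inverse x′ of x divides ε = x′ ∙ x, and ε ∈ S.
    invertibleIn-closed : ∀ {x} → S x → InvertibleIn H x → InvertibleIn S x
    invertibleIn-closed {x} Sx (x′ , Hx′ , x∙x′≈ε) =
      x′ , closed x′ ε Hx′ ε∈ (x , ⊆H x Sx , ≈-sym (≈-trans (∙-comm x′ x) x∙x′≈ε))
         , x∙x′≈ε

    isAtomIn⇔∈×isAtomIn : ∀ x → IsAtomIn S x ⇔ (S x × IsAtomIn H x)
    isAtomIn⇔∈×isAtomIn x = mk⇔ to from
      where
      to : IsAtomIn S x → S x × IsAtomIn H x
      to (Sx , ¬inv , factor) =
        Sx , ⊆H x Sx , (λ inv → ¬inv (invertibleIn-closed Sx inv)) ,
        λ u v Hu Hv x≈u∙v →
          Sum.map invertibleIn-⊆ invertibleIn-⊆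
            (factor u v (closed u x Hu Sx (v , Hv , x≈u∙v))
                        (closed v x Hv Sx (u , Hu , ≈-trans x≈u∙v (∙-comm u v)))
                        x≈u∙v)

      from : S x × IsAtomIn H x → IsAtomIn S x
      from (Sx , _ , ¬inv , factor) =
        Sx , (λ inv → ¬inv (invertibleIn-⊆ inv)) ,
        λ u v Su Sv x≈u∙v →
          Sum.map (invertibleIn-closed Su) (invertibleIn-closed Sv)
            (factor u v (⊆H u Su) (⊆H v Sv) x≈u∙v)

module Sumset {c ℓ} (M : CommutativeMonoid c ℓ) where
  open CommutativeMonoid M renaming (Carrier to A; _∙_ to _+_; ε to 0#)
  open SetoidMembership setoid using (_∈_)

  ∈-resp-≈ : ∀ {B x y} → x ≈ y → x ∈ B → y ∈ B
  ∈-resp-≈ {B} = SetoidMembershipProperties.∈-resp-≈ setoid {B}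

  private
    _≋′_ = _≋_ M
    _⊕′_ = _⊕_ M

  ≋-sym : Symmetric _≋′_
  ≋-sym B≋C x = ⇔.sym (B≋C x)

  ≋-trans : Transitive _≋′_
  ≋-trans B≋C C≋D x = ⇔.trans (B≋C x) (C≋D x)

  ∈-⊕⁺ : ∀ {B C x y} → x ∈ B → y ∈ C → (x + y) ∈ (B ⊕′ C)
  ∈-⊕⁺ = SetoidMembershipProperties.∈-cartesianProductWith⁺ setoid setoid setoid ∙-cong

  ∈-⊕⁻ : ∀ B C {x} → x ∈ (B ⊕′ C) → ∃₂ λ y z → y ∈ B × z ∈ C × x ≈ (y + z)
  ∈-⊕⁻ = SetoidMembershipProperties.∈-cartesianProductWith⁻ setoid setoid setoid _+_

  ⊕-comm : Commutative _≋′_ _⊕′_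
  ⊕-comm B C x = mk⇔ (swap B C) (swap C B)
    where
    swap : ∀ B C {x} → x ∈ (B ⊕′ C) → x ∈ (C ⊕′ B)
    swap B C x∈ with ∈-⊕⁻ B C x∈
    ... | y , z , y∈B , z∈C , x≈y+z = ∈-resp-≈ (trans (comm z y) (sym x≈y+z)) (∈-⊕⁺ z∈C y∈B)

  ⊆-⊕ˡ : ∀ {B C x} → 0# ∈ C → x ∈ B → x ∈ (B ⊕′ C)
  ⊆-⊕ˡ {x = x} 0∈C x∈B = ∈-resp-≈ (identityʳ x) (∈-⊕⁺ x∈B 0∈C)

  module _ {p} {P : Pred A p} (P-resp : ∀ x y → x ≈ y → P x → P y) where

    private
      lookup : ∀ {B x} → All P B → x ∈ B → P x
      lookup PB = lookupₛ setoid (λ {x} {y} → P-resp x y) PB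

    All-resp-≋ : ∀ {B C} → B ≋′ C → All P B → All P C
    All-resp-≋ B≋C PB = tabulateₛ setoid λ {x} x∈C →
      lookup PB (Equivalence.from (B≋C x) x∈C)

    All-⊕⁻ˡ : ∀ {B C} → 0# ∈ C → All P (B ⊕′ C) → All P B
    All-⊕⁻ˡ 0∈C PB⊕C = tabulateₛ setoid λ x∈B → lookup PB⊕C (⊆-⊕ˡ 0∈C x∈B)

    All-⊕⁺ : (∀ x y → P x → P y → P (x + y)) →
             ∀ {B C} → All P B → All P C → All P (B ⊕′ C)
    All-⊕⁺ P-+ {B} {C} PB PC = tabulateₛ setoid λ x∈ →
      let y , z , y∈B , z∈C , x≈y+z = ∈-⊕⁻ B C x∈
      in P-resp _ _ (sym x≈y+z) (P-+ y z (lookup PB y∈B) (lookup PC z∈C))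

module RestrictedPowerMonoid {c ℓ n} (M : CommutativeMonoid c ℓ)
  {N : Pred (CommutativeMonoid.Carrier M) n} (N≤M : IsSubmonoid M N) where
  open CommutativeMonoid M renaming (_∙_ to _+_; ε to 0#)
  open IsSubmonoid N≤M
  open Sumset M
  open PowerMonoid M

  Pfin0Sub-isSubmonoidOf : IsSubmonoidOf (Pfin0Sub M N) (Pfin0 M)
  Pfin0Sub-isSubmonoidOf = record
    { ⊆H       = λ _ → proj₁
    ; ε∈       = here refl , 0∈ ∷ []
    ; ∙-closed = λ B C (0∈B , NB) (0∈C , NC) →
        ⊆-⊕ˡ 0∈C 0∈B , All-⊕⁺ resp +-closed NB NC
    ; resp     = λ B C B≋C (0∈B , NB) →
        Equivalence.to (B≋C 0#) 0∈B , All-resp-≋ resp B≋C NB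
    }

  Pfin0Sub-divisorClosed : DivisorClosedIn (Pfin0Sub M N) (Pfin0 M)
  Pfin0Sub-divisorClosed B C 0∈B (_ , NC) (B′ , 0∈B′ , C≋B⊕B′) =
    0∈B , All-⊕⁻ˡ resp 0∈B′ (All-resp-≋ resp C≋B⊕B′ NC)

proposition2p1 : ∀ {c ℓ n} (M : CommutativeMonoid c ℓ) →
    Cancellative M → Reduced M →
    (N : Pred (CommutativeMonoid.Carrier M) n) → IsSubmonoid M N →
    (PowerMonoid.IsSubmonoidOf M (Pfin0Sub M N) (Pfin0 M)
      × PowerMonoid.DivisorClosedIn M (Pfin0Sub M N) (Pfin0 M))
    × (∀ (S : List (CommutativeMonoid.Carrier M)) →
        PowerMonoid.IsAtomIn M (Pfin0Sub M N) S
          ⇔ (Pfin0Sub M N S × PowerMonoid.IsAtomIn M (Pfin0 M) S))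
proposition2p1 M _ _ N N≤M =
  (Pfin0Sub-isSubmonoidOf , Pfin0Sub-divisorClosed) ,
  isAtomIn⇔∈×isAtomIn Pfin0Sub-isSubmonoidOf Pfin0Sub-divisorClosed
  where
  open Sumset M using (≋-sym; ≋-trans; ⊕-comm)
  open RestrictedPowerMonoid M N≤M
  open DivisorClosedSubmonoid {_≈_ = _≋_ M} {_∙_ = _⊕_ M} {ε = 𝟘 M} ≋-sym ≋-trans ⊕-comm
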